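{- For each \(m\in\{3,5\}\) there exist functions \(d_t:A_{7,m}\times\mathbb Z_7\to\mathbb Z_7\), \(t\in\mathbb Z_m\), such that: (1) for every \(t\in\mathbb Z_m\) and \(w\in A_{7,m}\), the map \(\kappa\mapsto d_t(w,\kappa)\) is a permutation of \(\mathbb Z_7\); (2) for every \(t\in\mathbb Z_m\) and \(\kappa\in\mathbb Z_7\), the map \(P_{t,\kappa}(w)=w+q_{d_t(w,\kappa)}\) is a bijection of \(A_{7,m}\); (3) for every \(\kappa\in\mathbb Z_7\), the composition \(P_{m-1,\kappa}\circ\cdots\circ P_{0,\kappa}\) is a single cycle on \(A_{7,m}\), of length \(m^6\).
   Context: \(A_{7,m}=\{w=(w_0,\ldots,w_6)\in(\mathbb Z_m)^7:\sum_i w_i=0\}\); \(e_0,\ldots,e_6\) are the standard basis vectors of \((\mathbb Z_m)^7\); \(q_i=e_i-e_6\) for \(0\le i\le5\) and \(q_6=0\). Such a family is called a valid \((7,m)\)-root-flat certificate. -}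

module Defs where

open import Data.Nat as ℕ using (ℕ; zero; suc; NonZero; _%_; _∸_; _<_; _^_)
open import Data.Nat.Properties as ℕP using (+-assoc; +-comm)
open import Data.Nat.DivMod using (_mod_; %-distribˡ-+; m%n%n≡m%n)
open import Data.Fin as Fin using (Fin; toℕ; _≟_)
open import Data.Fin.Properties using (toℕ-fromℕ<; toℕ-injective)
open import Data.Vec as Vec using (Vec; []; _∷_; tabulate; zipWith; replicate)
open import Data.List as List using (List; allFin; foldl)
open import Data.Bool using (if_then_else_)
open import Data.Product using (Σ; ∃; _×_; _,_; proj₁)
open import Relation.Nullary using (¬_)
open import Relation.Nullary.Decidable using (⌊_⌋)
open import Relation.Binary.PropositionalEquality
open import Function.Definitions using (Bijective)

iter : {X : Set} → (X → X) → ℕ → X → X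
iter f zero    x = x
iter f (suc n) x = f (iter f n x)

IsSingleCycle : {X : Set} → (X → X) → ℕ → Set
IsSingleCycle {X} f len =
  ((a b : X) → ∃ λ k → iter f k a ≡ b)
  × ((a : X) → iter f len a ≡ a)
  × ((a : X) (k : ℕ) → 0 < k → k < len → ¬ (iter f k a ≡ a))

six : Fin 7
six = Fin.fromℕ 6

module Z (m : ℕ) .{{nz : NonZero m}} where

  0ᶻ 1ᶻ : Fin m
  0ᶻ = 0 mod m
  1ᶻ = 1 mod m

  infixl 6 _+ᶻ_
  _+ᶻ_ : Fin m → Fin m → Fin m
  a +ᶻ b = (toℕ a ℕ.+ toℕ b) mod m

  -ᶻ_ : Fin m → Fin m
  -ᶻ a = (m ∸ toℕ a) mod m

  V : Set
  V = Vec (Fin m) 7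

  _⊕_ _⊖_ : V → V → V
  u ⊕ v = zipWith _+ᶻ_ u v
  u ⊖ v = zipWith (λ a b → a +ᶻ (-ᶻ b)) u v

  Σᶻ : ∀ {n} → Vec (Fin m) n → Fin m
  Σᶻ []       = 0ᶻ
  Σᶻ (x ∷ xs) = x +ᶻ Σᶻ xs

  InA : V → Set
  InA w = Σᶻ w ≡ 0ᶻ

  A : Set
  A = Σ V InA

  e : Fin 7 → V
  e i = tabulate (λ j → if ⌊ j ≟ i ⌋ then 1ᶻ else 0ᶻ)

  q : Fin 7 → V
  q i = if ⌊ i ≟ six ⌋ then replicate 7 0ᶻ else (e i ⊖ e six)

  private
    toℕ-mod : ∀ x → toℕ (x mod m) ≡ x % m
    toℕ-mod x = toℕ-fromℕ< _

    sumℕ : ∀ {n} → Vec (Fin m) n → ℕ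
    sumℕ []       = 0
    sumℕ (x ∷ xs) = toℕ x ℕ.+ sumℕ xs

    modˡ : ∀ a b → (a % m ℕ.+ b) % m ≡ (a ℕ.+ b) % m
    modˡ a b = begin
      (a % m ℕ.+ b) % m          ≡⟨ %-distribˡ-+ (a % m) b m ⟩
      (a % m % m ℕ.+ b % m) % m  ≡⟨ cong (λ z → (z ℕ.+ b % m) % m) (m%n%n≡m%n a m) ⟩
      (a % m ℕ.+ b % m) % m      ≡⟨ sym (%-distribˡ-+ a b m) ⟩
      (a ℕ.+ b) % m              ∎
      where open ≡-Reasoning

    modʳ : ∀ a b → (a ℕ.+ b % m) % m ≡ (a ℕ.+ b) % m
    modʳ a b = begin
      (a ℕ.+ b % m) % m  ≡⟨ cong (_% m) (+-comm a (b % m)) ⟩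
      (b % m ℕ.+ a) % m  ≡⟨ modˡ b a ⟩
      (b ℕ.+ a) % m      ≡⟨ cong (_% m) (+-comm b a) ⟩
      (a ℕ.+ b) % m      ∎
      where open ≡-Reasoning

    Σᶻ-ℕ : ∀ {n} (v : Vec (Fin m) n) → toℕ (Σᶻ v) ≡ sumℕ v % m
    Σᶻ-ℕ []       = toℕ-mod 0
    Σᶻ-ℕ (x ∷ xs) = begin
      toℕ (x +ᶻ Σᶻ xs)                ≡⟨ toℕ-mod _ ⟩
      (toℕ x ℕ.+ toℕ (Σᶻ xs)) % m     ≡⟨ cong (λ z → (toℕ x ℕ.+ z) % m) (Σᶻ-ℕ xs) ⟩
      (toℕ x ℕ.+ sumℕ xs % m) % m     ≡⟨ modʳ (toℕ x) (sumℕ xs) ⟩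
      (toℕ x ℕ.+ sumℕ xs) % m         ∎
      where open ≡-Reasoning

    sum-⊕ : ∀ {n} (u v : Vec (Fin m) n) →
            sumℕ (zipWith _+ᶻ_ u v) % m ≡ (sumℕ u ℕ.+ sumℕ v) % m
    sum-⊕ [] [] = refl
    sum-⊕ (x ∷ u) (y ∷ v) = begin
      (toℕ (x +ᶻ y) ℕ.+ S) % m                    ≡⟨ cong (λ z → (z ℕ.+ S) % m) (toℕ-mod _) ⟩
      ((toℕ x ℕ.+ toℕ y) % m ℕ.+ S) % m           ≡⟨ modˡ _ S ⟩
      ((toℕ x ℕ.+ toℕ y) ℕ.+ S) % m               ≡⟨ sym (modʳ _ S) ⟩
      ((toℕ x ℕ.+ toℕ y) ℕ.+ S % m) % m           ≡⟨ cong (λ z → ((toℕ x ℕ.+ toℕ y) ℕ.+ z) % m) (sum-⊕ u v) ⟩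
      ((toℕ x ℕ.+ toℕ y) ℕ.+ (U ℕ.+ W) % m) % m   ≡⟨ modʳ _ (U ℕ.+ W) ⟩
      ((toℕ x ℕ.+ toℕ y) ℕ.+ (U ℕ.+ W)) % m       ≡⟨ cong (_% m) (shuffle (toℕ x) (toℕ y) U W) ⟩
      ((toℕ x ℕ.+ U) ℕ.+ (toℕ y ℕ.+ W)) % m       ∎
      where
        open ≡-Reasoning
        S = sumℕ (zipWith _+ᶻ_ u v)
        U = sumℕ u
        W = sumℕ v
        shuffle : ∀ a b c d → (a ℕ.+ b) ℕ.+ (c ℕ.+ d) ≡ (a ℕ.+ c) ℕ.+ (b ℕ.+ d)
        shuffle a b c d = begin
          (a ℕ.+ b) ℕ.+ (c ℕ.+ d)   ≡⟨ +-assoc a b (c ℕ.+ d) ⟩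
          a ℕ.+ (b ℕ.+ (c ℕ.+ d))   ≡⟨ cong (a ℕ.+_) (sym (+-assoc b c d)) ⟩
          a ℕ.+ ((b ℕ.+ c) ℕ.+ d)   ≡⟨ cong (λ z → a ℕ.+ (z ℕ.+ d)) (+-comm b c) ⟩
          a ℕ.+ ((c ℕ.+ b) ℕ.+ d)   ≡⟨ cong (a ℕ.+_) (+-assoc c b d) ⟩
          a ℕ.+ (c ℕ.+ (b ℕ.+ d))   ≡⟨ sym (+-assoc a c (b ℕ.+ d)) ⟩
          (a ℕ.+ c) ℕ.+ (b ℕ.+ d)   ∎

  InA-⊕ : ∀ {u v} → InA u → InA v → InA (u ⊕ v)
  InA-⊕ {u} {v} hu hv = toℕ-injective (begin
    toℕ (Σᶻ (u ⊕ v))               ≡⟨ Σᶻ-ℕ (u ⊕ v) ⟩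
    sumℕ (u ⊕ v) % m               ≡⟨ sum-⊕ u v ⟩
    (sumℕ u ℕ.+ sumℕ v) % m        ≡⟨ sym (modˡ (sumℕ u) (sumℕ v)) ⟩
    (sumℕ u % m ℕ.+ sumℕ v) % m    ≡⟨ sym (modʳ (sumℕ u % m) (sumℕ v)) ⟩
    (sumℕ u % m ℕ.+ sumℕ v % m) % m ≡⟨ cong₂ (λ a b → (a ℕ.+ b) % m) (trans (sym (Σᶻ-ℕ u)) (cong toℕ hu)) (trans (sym (Σᶻ-ℕ v)) (cong toℕ hv)) ⟩
    (toℕ 0ᶻ ℕ.+ toℕ 0ᶻ) % m        ≡⟨ cong₂ (λ a b → (a ℕ.+ b) % m) (toℕ-mod 0) (toℕ-mod 0) ⟩
    (0 % m ℕ.+ 0 % m) % m          ≡⟨ sym (%-distribˡ-+ 0 0 m) ⟩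
    0 % m                          ≡⟨ sym (toℕ-mod 0) ⟩
    toℕ 0ᶻ                         ∎)
    where open ≡-Reasoning

  -- Valid (7,m)-root-flat certificate, given that each q_i lies in A_{7,m}
  -- (a fact checked by computation below for m = 3, 5; needed so that
  --  P_{t,κ}(w) = w + q_{d_t(w,κ)} is a self-map of A_{7,m}).
  module Cert (q∈A : ∀ i → InA (q i)) where

    P : (d : Fin m → A → Fin 7 → Fin 7) → Fin m → Fin 7 → A → A
    P d t κ (w , hw) = (w ⊕ q (d t (w , hw) κ)) , InA-⊕ {w} {q (d t (w , hw) κ)} hw (q∈A (d t (w , hw) κ))

    -- P_{m-1,κ} ∘ ⋯ ∘ P_{0,κ}   (P_0 applied first)
    sweep : (d : Fin m → A → Fin 7 → Fin 7) → Fin 7 → A → A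
    sweep d κ w = foldl (λ x t → P d t κ x) w (allFin m)

    IsCertificate : (Fin m → A → Fin 7 → Fin 7) → Set
    IsCertificate d =
      ((t : Fin m) (w : A) → Bijective _≡_ _≡_ (λ κ → d t w κ))
      × ((t : Fin m) (κ : Fin 7) → Bijective _≡_ _≡_ (P d t κ))
      × ((κ : Fin 7) → IsSingleCycle (sweep d κ) (m ^ 6))

q∈A-3 : ∀ i → Z.InA 3 (Z.q 3 i)
q∈A-3 Fin.zero = refl
q∈A-3 (Fin.suc Fin.zero) = refl
q∈A-3 (Fin.suc (Fin.suc Fin.zero)) = refl
q∈A-3 (Fin.suc (Fin.suc (Fin.suc Fin.zero))) = refl
q∈A-3 (Fin.suc (Fin.suc (Fin.suc (Fin.suc Fin.zero)))) = refl
q∈A-3 (Fin.suc (Fin.suc (Fin.suc (Fin.suc (Fin.suc Fin.zero))))) = refl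
q∈A-3 (Fin.suc (Fin.suc (Fin.suc (Fin.suc (Fin.suc (Fin.suc Fin.zero)))))) = refl

q∈A-5 : ∀ i → Z.InA 5 (Z.q 5 i)
q∈A-5 Fin.zero = refl
q∈A-5 (Fin.suc Fin.zero) = refl
q∈A-5 (Fin.suc (Fin.suc Fin.zero)) = refl
q∈A-5 (Fin.suc (Fin.suc (Fin.suc Fin.zero))) = refl
q∈A-5 (Fin.suc (Fin.suc (Fin.suc (Fin.suc Fin.zero)))) = refl
q∈A-5 (Fin.suc (Fin.suc (Fin.suc (Fin.suc (Fin.suc Fin.zero))))) = refl
q∈A-5 (Fin.suc (Fin.suc (Fin.suc (Fin.suc (Fin.suc (Fin.suc Fin.zero)))))) = refl

HasCertificate3 HasCertificate5 : Set
HasCertificate3 = ∃ λ d → Z.Cert.IsCertificate 3 q∈A-3 d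
HasCertificate5 = ∃ λ d → Z.Cert.IsCertificate 5 q∈A-5 d

{-# OPTIONS --safe #-}
module Submission where

-- Every certificate below has the shape
--   d_t(w, κ) = σ(κ) + c_t,   σ(κ) = κ + j_t, κ − j_t or κ,
-- where σ moves κ forward when an "edge" fires at κ (coordinate κ + a_t of w equals its target value
-- while coordinate κ + j_t + a_t does not) and backward when one fires at κ − j_t.  Edges never fire at
-- both k and k + j_t, so σ is an involution and κ ↦ d_t(w, κ) is a permutation: property (1).
-- Moving along q_x − q_y = e_x − e_y only changes coordinates x and y.  If a_t − c_t ∉ {0, ±j_t}, the
-- coordinates that decide d = d_t(w, κ) avoid d and κ + c_t, so w ↦ w + (q_d − q_{κ+c_t}) is a shear
-- along a function it does not disturb; P_{t,κ} is that shear followed by a translation, hence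
-- bijective: property (2).  For (3) the orbit of 0 under each composite is computed and first returns
-- after m^6 steps; since A_{7,m} injects into (ℤ_m)^6, that orbit is all of A_{7,m}.

open import Defs
open import Algebra.Bundles using (AbelianGroup)
open import Algebra.Structures using (IsAbelianGroup)
open import Algebra.Consequences.Propositional using (comm∧idˡ⇒id; comm∧invˡ⇒inv)
import Algebra.Properties.AbelianGroup as AbelianGroupProperties
import Algebra.Properties.CommutativeSemigroup as CommutativeSemigroupProperties
import Axiom.UniquenessOfIdentityProofs as UIP
open import Data.Bool using (Bool; true; false; if_then_else_; not; _∧_)
open import Data.Fin as Fin using (Fin; toℕ; _≟_; #_; funToFin; finToFun)
open import Data.Fin.Patterns
open import Data.Fin.Properties using (toℕ-fromℕ<; toℕ-injective; toℕ<n; toℕ≤n; pigeonhole; finToFun-funToFin)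
open import Data.List as List using (foldl; allFin)
open import Data.Nat using (ℕ; zero; suc; NonZero; >-nonZero⁻¹; _+_; _∸_; _%_; _^_; _<_; s<s; s<s⁻¹)
open import Data.Nat.DivMod using (_mod_; %-distribˡ-+; m%n%n≡m%n; m<n⇒m%n≡m; n%n≡0)
open import Data.Nat.Properties using (+-assoc; +-comm; m+[n∸m]≡n; m∸n+n≡m; <⇒≤; ≤-<-trans; m∸n≤m; m<n⇒0<n∸m; n<1+n)
open import Data.Product using (_×_; _,_; proj₁; proj₂; ∃)
open import Data.Vec using (Vec; []; _∷_; _∷ʳ_; zipWith; map; lookup; replicate; init)
open import Data.Vec.Properties
  using (≡-dec; ∷-injective; zipWith-replicate₂; map-cong; map-id; lookup-zipWith; lookup∘tabulate; lookup-replicate; tabulate∘lookup; tabulate-cong)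
open import Function using (_∘_; id; flip)
open import Function.Definitions using (Bijective; Injective; Surjective)
open import Function.Consequences.Propositional
  using (inverseᵇ⇒bijective; strictlyInverseˡ⇒inverseˡ; strictlyInverseʳ⇒inverseʳ; strictlySurjective⇒surjective)
open import Level using (0ℓ)
open import Relation.Binary.Definitions using (DecidableEquality)
open import Relation.Binary.PropositionalEquality
open import Relation.Binary.PropositionalEquality.Algebra using (isMagma)
open import Relation.Nullary using (does; yes; no; contradiction)
open import Relation.Nullary.Decidable using (⌊_⌋; isYes≗does; dec-false)

open ≡-Reasoning

strictlyInverseᵇ⇒bijective : {A B : Set} {f : A → B} (g : B → A) →
                             (∀ y → f (g y) ≡ y) → (∀ x → g (f x) ≡ x) → Bijective _≡_ _≡_ f
strictlyInverseᵇ⇒bijective {f = f} g fg gf =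
  inverseᵇ⇒bijective (strictlyInverseˡ⇒inverseˡ f fg , strictlyInverseʳ⇒inverseʳ f gf)

foldl-fusion : {X Y T : Set} (π : X → Y) {f : X → T → X} {g : Y → T → Y} →
               (∀ x t → π (f x t) ≡ g (π x) t) → ∀ x ts → π (foldl f x ts) ≡ foldl g (π x) ts
foldl-fusion π         fuse x List.[]         = refl
foldl-fusion π {f} {g} fuse x (t List.∷ ts) =
  trans (foldl-fusion π fuse (f x t) ts) (cong (λ y → foldl g y ts) (fuse x t))

foldl-injective : {X T : Set} {f : X → T → X} → (∀ t → Injective _≡_ _≡_ (λ x → f x t)) →
                  ∀ ts → Injective _≡_ _≡_ (λ x → foldl f x ts)
foldl-injective f-injective List.[]         eq = eq
foldl-injective f-injective (t List.∷ ts) eq = f-injective t (foldl-injective f-injective ts eq)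

module _ {A : Set} {_∙_ _◇_ : A → A → A} where

  zipWith-cancelʳ : (∀ a b → (a ∙ b) ◇ b ≡ a) →
                    ∀ {n} (u v : Vec A n) → zipWith _◇_ (zipWith _∙_ u v) v ≡ u
  zipWith-cancelʳ cancel []      []      = refl
  zipWith-cancelʳ cancel (x ∷ u) (y ∷ v) = cong₂ _∷_ (cancel x y) (zipWith-cancelʳ cancel u v)

  zipWith-assocʳ : (∀ a b c → (a ∙ b) ◇ c ≡ a ∙ (b ◇ c)) →
                   ∀ {n} (u v w : Vec A n) → zipWith _◇_ (zipWith _∙_ u v) w ≡ zipWith _∙_ u (zipWith _◇_ v w)
  zipWith-assocʳ assoc []      []      []      = refl
  zipWith-assocʳ assoc (x ∷ u) (y ∷ v) (z ∷ w) = cong₂ _∷_ (assoc x y z) (zipWith-assocʳ assoc u v w)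

-- Iteration and single cycles

record ExactPeriod {X : Set} (f : X → X) (n : ℕ) (x : X) : Set where
  constructor exactPeriod
  field
    returns   : iter f n x ≡ x
    no-sooner : ∀ k → 0 < k → k < n → iter f k x ≢ x

module _ {X : Set} (f : X → X) where

  iter-+ : ∀ i j x → iter f (i + j) x ≡ iter f i (iter f j x)
  iter-+ zero    j x = refl
  iter-+ (suc i) j x = cong f (iter-+ i j x)

  iter-suc : ∀ i x → iter f (suc i) x ≡ iter f i (f x)
  iter-suc i x = trans (cong (λ n → iter f n x) (+-comm 1 i)) (iter-+ i 1 x)

  iter-comm : ∀ i j x → iter f i (iter f j x) ≡ iter f j (iter f i x)
  iter-comm i j x = trans (sym (iter-+ i j x)) (trans (cong (λ n → iter f n x) (+-comm i j)) (iter-+ j i x))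

  iter-injective : Injective _≡_ _≡_ f → ∀ k → Injective _≡_ _≡_ (iter f k)
  iter-injective f-injective zero    eq = eq
  iter-injective f-injective (suc k) eq = iter-injective f-injective k (f-injective eq)

module _ {X : Set} (_≟ₓ_ : DecidableEquality X) (f : X → X) (x : X) where

  firstHitAt : ℕ → X → Bool
  firstHitAt zero    y = does (y ≟ₓ x)
  firstHitAt (suc n) y = not (does (y ≟ₓ x)) ∧ firstHitAt n (f y)

  firstHitAt-sound : ∀ n y → firstHitAt n y ≡ true →
                     iter f n y ≡ x × (∀ k → k < n → iter f k y ≢ x)
  firstHitAt-sound zero y hit with y ≟ₓ x
  ... | yes y≡x = y≡x , λ _ ()
  firstHitAt-sound (suc n) y hit with y ≟ₓ x
  ... | no y≢x = trans (iter-suc f n y) (proj₁ later) , missed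
    where
      later : iter f n (f y) ≡ x × (∀ k → k < n → iter f k (f y) ≢ x)
      later = firstHitAt-sound n (f y) hit
      missed : ∀ k → k < suc n → iter f k y ≢ x
      missed zero    _   = y≢x
      missed (suc k) k<n = proj₂ later k (s<s⁻¹ k<n) ∘ trans (sym (iter-suc f k y))

  firstHitAt⇒exactPeriod : ∀ {N} n → N ≡ suc n → firstHitAt n (f x) ≡ true → ExactPeriod f N x
  firstHitAt⇒exactPeriod n refl hit = exactPeriod (trans (iter-suc f n x) (proj₁ later)) no-sooner
    where
      later : iter f n (f x) ≡ x × (∀ k → k < n → iter f k (f x) ≢ x)
      later = firstHitAt-sound n (f x) hit
      no-sooner : ∀ k → 0 < k → k < suc n → iter f k x ≢ x
      no-sooner (suc k) _ k<n = proj₂ later k (s<s⁻¹ k<n) ∘ trans (sym (iter-suc f k x))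

module _ {X Y : Set} {f : X → X} {g : Y → Y} {π : X → Y}
         (π-injective : Injective _≡_ _≡_ π) (π-semiconj : ∀ x → π (f x) ≡ g (π x)) where

  iter-semiconj : ∀ k x → π (iter f k x) ≡ iter g k (π x)
  iter-semiconj zero    x = refl
  iter-semiconj (suc k) x = trans (π-semiconj (iter f k x)) (cong g (iter-semiconj k x))

  exactPeriod-reflect : ∀ {n x} → ExactPeriod g n (π x) → ExactPeriod f n x
  exactPeriod-reflect {n} {x} (exactPeriod returns no-sooner) = exactPeriod
    (π-injective (trans (iter-semiconj n x) returns))
    (λ k 0<k k<n eq → no-sooner k 0<k k<n (trans (sym (iter-semiconj k x)) (cong π eq)))

module _ {X : Set} (f : X → X) {N : ℕ} (f-injective : Injective _≡_ _≡_ f)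
         (encode : X → Fin N) (encode-injective : Injective _≡_ _≡_ encode)
         {x₀ : X} (x₀-period : ExactPeriod f N x₀) where

  open ExactPeriod x₀-period

  private
    orbit : ℕ → X
    orbit i = iter f i x₀

  orbit-injective : ∀ {i j} → i < j → j < N → orbit i ≢ orbit j
  orbit-injective {i} {j} i<j j<N eq =
    no-sooner (j ∸ i) (m<n⇒0<n∸m i<j) (≤-<-trans (m∸n≤m j i) j<N) (sym (iter-injective f f-injective i (begin
      orbit i                        ≡⟨ eq ⟩
      iter f j x₀                    ≡⟨ cong (λ n → iter f n x₀) (m+[n∸m]≡n (<⇒≤ i<j)) ⟨
      iter f (i + (j ∸ i)) x₀        ≡⟨ iter-+ f i (j ∸ i) x₀ ⟩
      iter f i (iter f (j ∸ i) x₀)   ∎)))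

  private
    tagged : X → Fin (suc N) → Fin N
    tagged y 0F          = encode y
    tagged y (Fin.suc i) = encode (orbit (toℕ i))

  -- N distinct orbit points inside a set that injects into Fin N exhaust it.
  orbit-surjective : ∀ y → ∃ λ i → i < N × orbit i ≡ y
  orbit-surjective y with pigeonhole (n<1+n N) (tagged y)
  ... | 0F        , Fin.suc j , _       , eq = toℕ j , toℕ<n j , encode-injective (sym eq)
  ... | Fin.suc i , Fin.suc j , s<s i<j , eq =
    contradiction (encode-injective eq) (orbit-injective i<j (toℕ<n j))

  private
    index : X → ℕ
    index y = proj₁ (orbit-surjective y)

    index<N : ∀ y → index y < N
    index<N y = proj₁ (proj₂ (orbit-surjective y))

    orbit-index : ∀ y → orbit (index y) ≡ y
    orbit-index y = proj₂ (proj₂ (orbit-surjective y))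

  returns-to-x₀ : ∀ y → iter f (N ∸ index y) y ≡ x₀
  returns-to-x₀ y = begin
    iter f (N ∸ index y) y                 ≡⟨ cong (iter f (N ∸ index y)) (orbit-index y) ⟨
    iter f (N ∸ index y) (orbit (index y)) ≡⟨ iter-+ f (N ∸ index y) (index y) x₀ ⟨
    iter f (N ∸ index y + index y) x₀      ≡⟨ cong (λ n → iter f n x₀) (m∸n+n≡m (<⇒≤ (index<N y))) ⟩
    iter f N x₀                            ≡⟨ returns ⟩
    x₀                                     ∎

  exactPeriod⇒isSingleCycle : IsSingleCycle f N
  exactPeriod⇒isSingleCycle = reach , periodic , aperiodic
    where
      reach : ∀ y z → ∃ λ k → iter f k y ≡ z
      reach y z = index z + (N ∸ index y) , (begin
        iter f (index z + (N ∸ index y)) y          ≡⟨ iter-+ f (index z) (N ∸ index y) y ⟩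
        iter f (index z) (iter f (N ∸ index y) y)   ≡⟨ cong (iter f (index z)) (returns-to-x₀ y) ⟩
        orbit (index z)                             ≡⟨ orbit-index z ⟩
        z                                           ∎)

      periodic : ∀ y → iter f N y ≡ y
      periodic y = begin
        iter f N y                       ≡⟨ cong (iter f N) (orbit-index y) ⟨
        iter f N (orbit (index y))       ≡⟨ iter-comm f N (index y) x₀ ⟩
        iter f (index y) (iter f N x₀)   ≡⟨ cong (iter f (index y)) returns ⟩
        orbit (index y)                  ≡⟨ orbit-index y ⟩
        y                                ∎

      aperiodic : ∀ y k → 0 < k → k < N → iter f k y ≢ y
      aperiodic y k 0<k k<N eq = no-sooner k 0<k k<N (iter-injective f f-injective (index y) (begin
        iter f (index y) (iter f k x₀)   ≡⟨ iter-comm f (index y) k x₀ ⟩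
        iter f k (orbit (index y))       ≡⟨ cong (iter f k) (orbit-index y) ⟩
        iter f k y                       ≡⟨ eq ⟩
        y                                ≡⟨ orbit-index y ⟨
        orbit (index y)                  ∎))

-- Shears

module Shear {X : Set} (_⊕_ _⊖_ : X → X → X)
  (⊕-⊖-cancel : ∀ x y → (x ⊕ y) ⊖ y ≡ x)
  (⊖-⊕-cancel : ∀ x y → (x ⊖ y) ⊕ y ≡ x)
  (⊕-⊖-assoc : ∀ x y z → (x ⊕ y) ⊖ z ≡ x ⊕ (y ⊖ z))
  (g : X → X) (o : X)
  (g-stable⁺ : ∀ x → g (x ⊕ (g x ⊖ o)) ≡ g x)
  (g-stable⁻ : ∀ x → g (x ⊖ (g x ⊖ o)) ≡ g x)
  where

  -- x ⊕ g x is the shear x ⊕ (g x ⊖ o), which g does not notice, followed by the translation by o.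
  shift : X → X
  shift x = x ⊕ g x

  unshift : X → X
  unshift y = (y ⊖ o) ⊖ (g (y ⊖ o) ⊖ o)

  private
    shift-⊖ : ∀ x → shift x ⊖ o ≡ x ⊕ (g x ⊖ o)
    shift-⊖ x = ⊕-⊖-assoc x (g x) o

  unshift-shift : ∀ x → unshift (shift x) ≡ x
  unshift-shift x = begin
    (shift x ⊖ o) ⊖ (g (shift x ⊖ o) ⊖ o)       ≡⟨ cong (λ u → u ⊖ (g u ⊖ o)) (shift-⊖ x) ⟩
    (x ⊕ (g x ⊖ o)) ⊖ (g (x ⊕ (g x ⊖ o)) ⊖ o)   ≡⟨ cong (λ v → (x ⊕ (g x ⊖ o)) ⊖ (v ⊖ o)) (g-stable⁺ x) ⟩
    (x ⊕ (g x ⊖ o)) ⊖ (g x ⊖ o)                 ≡⟨ ⊕-⊖-cancel x (g x ⊖ o) ⟩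
    x                                           ∎

  shift-unshift : ∀ y → shift (unshift y) ≡ y
  shift-unshift y = begin
    shift v                   ≡⟨ ⊖-⊕-cancel (shift v) o ⟨
    (shift v ⊖ o) ⊕ o         ≡⟨ cong (_⊕ o) (shift-⊖ v) ⟩
    (v ⊕ (g v ⊖ o)) ⊕ o       ≡⟨ cong (λ w → (v ⊕ (w ⊖ o)) ⊕ o) (g-stable⁻ u) ⟩
    (v ⊕ (g u ⊖ o)) ⊕ o       ≡⟨ cong (_⊕ o) (⊖-⊕-cancel u (g u ⊖ o)) ⟩
    u ⊕ o                     ≡⟨ ⊖-⊕-cancel y o ⟩
    y                         ∎
    where
      u v : X
      u = y ⊖ o
      v = unshift y

-- ℤ/m

module ZProperties (m : ℕ) .{{_ : NonZero m}} where
  open Z m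

  private
    toℕ-mod : ∀ n → toℕ (n mod m) ≡ n % m
    toℕ-mod n = toℕ-fromℕ< _

    %-absorbˡ : ∀ a b → (a % m + b) % m ≡ (a + b) % m
    %-absorbˡ a b = begin
      (a % m + b) % m          ≡⟨ %-distribˡ-+ (a % m) b m ⟩
      (a % m % m + b % m) % m  ≡⟨ cong (λ x → (x + b % m) % m) (m%n%n≡m%n a m) ⟩
      (a % m + b % m) % m      ≡⟨ %-distribˡ-+ a b m ⟨
      (a + b) % m              ∎

  +ᶻ-comm : ∀ a b → a +ᶻ b ≡ b +ᶻ a
  +ᶻ-comm a b = cong (λ n → n mod m) (+-comm (toℕ a) (toℕ b))

  +ᶻ-assoc : ∀ a b c → (a +ᶻ b) +ᶻ c ≡ a +ᶻ (b +ᶻ c)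
  +ᶻ-assoc a b c = toℕ-injective (begin
    toℕ ((a +ᶻ b) +ᶻ c)        ≡⟨ toℕ-mod _ ⟩
    (toℕ (a +ᶻ b) + z) % m     ≡⟨ cong (λ n → (n + z) % m) (toℕ-mod _) ⟩
    ((x + y) % m + z) % m      ≡⟨ %-absorbˡ (x + y) z ⟩
    (x + y + z) % m            ≡⟨ cong (_% m) (+-assoc x y z) ⟩
    (x + (y + z)) % m          ≡⟨ cong (_% m) (+-comm x (y + z)) ⟩
    ((y + z) + x) % m          ≡⟨ %-absorbˡ (y + z) x ⟨
    ((y + z) % m + x) % m      ≡⟨ cong (λ n → (n + x) % m) (toℕ-mod _) ⟨
    (toℕ (b +ᶻ c) + x) % m     ≡⟨ cong (_% m) (+-comm (toℕ (b +ᶻ c)) x) ⟩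
    (x + toℕ (b +ᶻ c)) % m     ≡⟨ toℕ-mod _ ⟨
    toℕ (a +ᶻ (b +ᶻ c))        ∎)
    where
      x y z : ℕ
      x = toℕ a
      y = toℕ b
      z = toℕ c

  +ᶻ-identityˡ : ∀ a → 0ᶻ +ᶻ a ≡ a
  +ᶻ-identityˡ a = toℕ-injective (begin
    toℕ (0ᶻ +ᶻ a)           ≡⟨ toℕ-mod _ ⟩
    (toℕ 0ᶻ + toℕ a) % m    ≡⟨ cong (λ n → (n + toℕ a) % m) (toℕ-mod 0) ⟩
    (0 % m + toℕ a) % m     ≡⟨ %-absorbˡ 0 (toℕ a) ⟩
    toℕ a % m               ≡⟨ m<n⇒m%n≡m (toℕ<n a) ⟩
    toℕ a                   ∎)

  +ᶻ-inverseˡ : ∀ a → -ᶻ a +ᶻ a ≡ 0ᶻ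
  +ᶻ-inverseˡ a = toℕ-injective (begin
    toℕ (-ᶻ a +ᶻ a)                  ≡⟨ toℕ-mod _ ⟩
    (toℕ (-ᶻ a) + toℕ a) % m         ≡⟨ cong (λ n → (n + toℕ a) % m) (toℕ-mod (m ∸ toℕ a)) ⟩
    ((m ∸ toℕ a) % m + toℕ a) % m    ≡⟨ %-absorbˡ (m ∸ toℕ a) (toℕ a) ⟩
    (m ∸ toℕ a + toℕ a) % m          ≡⟨ cong (_% m) (m∸n+n≡m (toℕ≤n a)) ⟩
    m % m                            ≡⟨ n%n≡0 m ⟩
    0                                ≡⟨ m<n⇒m%n≡m (>-nonZero⁻¹ m) ⟨
    0 % m                            ≡⟨ toℕ-mod 0 ⟨
    toℕ 0ᶻ                           ∎)

  +ᶻ-isAbelianGroup : IsAbelianGroup _≡_ _+ᶻ_ 0ᶻ -ᶻ_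
  +ᶻ-isAbelianGroup = record
    { isGroup = record
      { isMonoid = record
        { isSemigroup = record { isMagma = isMagma _+ᶻ_ ; assoc = +ᶻ-assoc }
        ; identity    = comm∧idˡ⇒id +ᶻ-comm +ᶻ-identityˡ
        }
      ; inverse  = comm∧invˡ⇒inv +ᶻ-comm +ᶻ-inverseˡ
      ; ⁻¹-cong  = cong -ᶻ_
      }
    ; comm = +ᶻ-comm
    }

  +ᶻ-abelianGroup : AbelianGroup 0ℓ 0ℓ
  +ᶻ-abelianGroup = record { isAbelianGroup = +ᶻ-isAbelianGroup }

  open AbelianGroup +ᶻ-abelianGroup public using (inverseʳ; identityˡ; identityʳ)
  open AbelianGroupProperties +ᶻ-abelianGroup public
    using (ε⁻¹≈ε; ⁻¹-∙-comm; ∙-cancelˡ; ∙-cancelʳ; //-rightDividesˡ; //-rightDividesʳ)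
  open CommutativeSemigroupProperties (AbelianGroup.commutativeSemigroup +ᶻ-abelianGroup) public
    using (interchange)

  swapPairs : Fin m → (Fin m → Bool) → Fin m → Fin m
  swapPairs j b k = if b k then k +ᶻ j else if b (k +ᶻ -ᶻ j) then k +ᶻ -ᶻ j else k

  swapPairs-forward : ∀ {j} b {k} → b k ≡ true → swapPairs j b k ≡ k +ᶻ j
  swapPairs-forward b bk rewrite bk = refl

  swapPairs-backward : ∀ {j} b {k} → b k ≡ false → b (k +ᶻ -ᶻ j) ≡ true → swapPairs j b k ≡ k +ᶻ -ᶻ j
  swapPairs-backward b bk bk′ rewrite bk | bk′ = refl

  swapPairs-fixed : ∀ {j} b {k} → b k ≡ false → b (k +ᶻ -ᶻ j) ≡ false → swapPairs j b k ≡ k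
  swapPairs-fixed b bk bk′ rewrite bk | bk′ = refl

  swapPairs-involutive : ∀ j b → (∀ k → b k ∧ b (k +ᶻ j) ≡ false) →
                         ∀ k → swapPairs j b (swapPairs j b k) ≡ k
  swapPairs-involutive j b disjoint k with b k in bk
  ... | true with b (k +ᶻ j) in bkj
  ...   | true  with () ← trans (sym (cong₂ _∧_ bk bkj)) (disjoint k)
  ...   | false rewrite //-rightDividesʳ j k | bk = refl
  swapPairs-involutive j b disjoint k | false with b (k +ᶻ -ᶻ j) in bk′
  ...   | true  rewrite bk′ | //-rightDividesˡ j k = refl
  ...   | false rewrite bk | bk′ = refl

  swapPairs-translate-bijective : ∀ j c b → (∀ k → b k ∧ b (k +ᶻ j) ≡ false) →
                                  Bijective _≡_ _≡_ (λ k → swapPairs j b k +ᶻ c)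
  swapPairs-translate-bijective j c b disjoint = strictlyInverseᵇ⇒bijective (λ k → swapPairs j b (k +ᶻ -ᶻ c))
    (λ k → trans (cong (_+ᶻ c) (swapPairs-involutive j b disjoint _)) (//-rightDividesˡ c k))
    (λ k → trans (cong (swapPairs j b) (//-rightDividesʳ c _)) (swapPairs-involutive j b disjoint k))

  edges : Fin m → (Fin m → Bool) → Fin m → Bool
  edges j r k = r k ∧ not (r (k +ᶻ j))

  edges-disjoint : ∀ j r k → edges j r k ∧ edges j r (k +ᶻ j) ≡ false
  edges-disjoint j r k = rise∧rise (r k) (r (k +ᶻ j)) _
    where
      rise∧rise : ∀ x y z → (x ∧ not y) ∧ (y ∧ z) ≡ false
      rise∧rise false y     z = refl
      rise∧rise true  true  z = refl
      rise∧rise true  false z = refl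

-- A_{7,m} and the vectors q_i

module VectorProperties (m : ℕ) .{{_ : NonZero m}} where
  open Z m
  open ZProperties m

  ⊕-⊖-cancel : ∀ u v → (u ⊕ v) ⊖ v ≡ u
  ⊕-⊖-cancel = zipWith-cancelʳ (λ a b → //-rightDividesʳ b a)

  ⊖-⊕-cancel : ∀ u v → (u ⊖ v) ⊕ v ≡ u
  ⊖-⊕-cancel = zipWith-cancelʳ (λ a b → //-rightDividesˡ b a)

  ⊕-⊖-assoc : ∀ u v w → (u ⊕ v) ⊖ w ≡ u ⊕ (v ⊖ w)
  ⊕-⊖-assoc = zipWith-assocʳ (λ a b c → +ᶻ-assoc a b (-ᶻ c))

  Σᶻ-⊖ : ∀ {n} (u v : Vec (Fin m) n) → Σᶻ (zipWith (λ a b → a +ᶻ -ᶻ b) u v) ≡ Σᶻ u +ᶻ -ᶻ Σᶻ v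
  Σᶻ-⊖ []      []      = sym (inverseʳ 0ᶻ)
  Σᶻ-⊖ (x ∷ u) (y ∷ v) = begin
    (x +ᶻ -ᶻ y) +ᶻ Σᶻ (zipWith (λ a b → a +ᶻ -ᶻ b) u v)   ≡⟨ cong ((x +ᶻ -ᶻ y) +ᶻ_) (Σᶻ-⊖ u v) ⟩
    (x +ᶻ -ᶻ y) +ᶻ (Σᶻ u +ᶻ -ᶻ Σᶻ v)                      ≡⟨ interchange x (-ᶻ y) (Σᶻ u) (-ᶻ Σᶻ v) ⟩
    (x +ᶻ Σᶻ u) +ᶻ (-ᶻ y +ᶻ -ᶻ Σᶻ v)                      ≡⟨ cong ((x +ᶻ Σᶻ u) +ᶻ_) (⁻¹-∙-comm y (Σᶻ v)) ⟩
    (x +ᶻ Σᶻ u) +ᶻ -ᶻ (y +ᶻ Σᶻ v)                         ∎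

  InA-⊖ : ∀ {u v} → InA u → InA v → InA (u ⊖ v)
  InA-⊖ {u} {v} u∈A v∈A = begin
    Σᶻ (u ⊖ v)        ≡⟨ Σᶻ-⊖ u v ⟩
    Σᶻ u +ᶻ -ᶻ Σᶻ v   ≡⟨ cong₂ (λ a b → a +ᶻ -ᶻ b) u∈A v∈A ⟩
    0ᶻ +ᶻ -ᶻ 0ᶻ       ≡⟨ inverseʳ 0ᶻ ⟩
    0ᶻ                ∎

  0⃗ : V
  0⃗ = replicate 7 0ᶻ

  0⃗∈A : InA 0⃗
  0⃗∈A = Σᶻ-replicate 7
    where
      Σᶻ-replicate : ∀ n → Σᶻ (replicate n 0ᶻ) ≡ 0ᶻ
      Σᶻ-replicate zero    = refl
      Σᶻ-replicate (suc n) = trans (cong (0ᶻ +ᶻ_) (Σᶻ-replicate n)) (identityˡ 0ᶻ)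

  A-≡ : {x y : A} → proj₁ x ≡ proj₁ y → x ≡ y
  A-≡ {w , p} {.w , p′} refl = cong (w ,_) (UIP.Decidable⇒UIP.≡-irrelevant _≟_ p p′)

  restrict-bijective : {F : A → A} {f f⁻¹ : V → V} →
                       (∀ x → proj₁ (F x) ≡ f (proj₁ x)) →
                       (∀ w → f (f⁻¹ w) ≡ w) → (∀ w → f⁻¹ (f w) ≡ w) →
                       (∀ w → InA w → InA (f⁻¹ w)) → Bijective _≡_ _≡_ F
  restrict-bijective {F} {f} {f⁻¹} F≗f f∘f⁻¹ f⁻¹∘f f⁻¹-closed = injective , surjective
    where
      injective : Injective _≡_ _≡_ F
      injective {x} {y} Fx≡Fy = A-≡ (begin
        proj₁ x             ≡⟨ f⁻¹∘f (proj₁ x) ⟨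
        f⁻¹ (f (proj₁ x))   ≡⟨ cong f⁻¹ (trans (sym (F≗f x)) (trans (cong proj₁ Fx≡Fy) (F≗f y))) ⟩
        f⁻¹ (f (proj₁ y))   ≡⟨ f⁻¹∘f (proj₁ y) ⟩
        proj₁ y             ∎)

      surjective : Surjective _≡_ _≡_ F
      surjective = strictlySurjective⇒surjective λ (w , w∈A) →
        (f⁻¹ w , f⁻¹-closed w w∈A) , A-≡ (trans (F≗f _) (f∘f⁻¹ w))

  e-off : ∀ {x l} → l ≢ x → lookup (e x) l ≡ 0ᶻ
  e-off {x} {l} l≢x = trans (lookup∘tabulate (λ j → if ⌊ j ≟ x ⌋ then 1ᶻ else 0ᶻ) l)
    (cong (if_then 1ᶻ else 0ᶻ) (trans (isYes≗does (l ≟ x)) (dec-false (l ≟ x) l≢x)))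

  q-off : ∀ {x l} → l ≢ x → lookup (q x) l ≡ -ᶻ lookup (e six) l
  q-off {x} {l} l≢x with x ≟ six
  ... | yes refl = begin
    lookup (replicate 7 0ᶻ) l   ≡⟨ lookup-replicate l 0ᶻ ⟩
    0ᶻ                          ≡⟨ ε⁻¹≈ε ⟨
    -ᶻ 0ᶻ                       ≡⟨ cong -ᶻ_ (e-off l≢x) ⟨
    -ᶻ lookup (e six) l         ∎
  ... | no _ = begin
    lookup (e x ⊖ e six) l                  ≡⟨ lookup-zipWith (λ a b → a +ᶻ -ᶻ b) l (e x) (e six) ⟩
    lookup (e x) l +ᶻ -ᶻ lookup (e six) l   ≡⟨ cong (_+ᶻ -ᶻ lookup (e six) l) (e-off l≢x) ⟩
    0ᶻ +ᶻ -ᶻ lookup (e six) l               ≡⟨ identityˡ _ ⟩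
    -ᶻ lookup (e six) l                     ∎

  -- because q x ⊖ q y = e x ⊖ e y, also when x or y is six
  q-⊖-off : ∀ {x y l} → l ≢ x → l ≢ y → lookup (q x ⊖ q y) l ≡ 0ᶻ
  q-⊖-off {x} {y} {l} l≢x l≢y = begin
    lookup (q x ⊖ q y) l                  ≡⟨ lookup-zipWith (λ a b → a +ᶻ -ᶻ b) l (q x) (q y) ⟩
    lookup (q x) l +ᶻ -ᶻ lookup (q y) l   ≡⟨ cong₂ (λ a b → a +ᶻ -ᶻ b) (q-off l≢x) (q-off l≢y) ⟩
    n +ᶻ -ᶻ n                             ≡⟨ inverseʳ n ⟩
    0ᶻ                                    ∎
    where
      n : Fin m
      n = -ᶻ lookup (e six) l

  AgreeOff : Fin 7 → Fin 7 → V → V → Set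
  AgreeOff x y w w′ = ∀ l → l ≢ x → l ≢ y → lookup w′ l ≡ lookup w l

  ⊕-q-⊖-agreeOff : ∀ x y w → AgreeOff x y w (w ⊕ (q x ⊖ q y))
  ⊕-q-⊖-agreeOff x y w l l≢x l≢y = begin
    lookup (w ⊕ (q x ⊖ q y)) l           ≡⟨ lookup-zipWith _+ᶻ_ l w (q x ⊖ q y) ⟩
    lookup w l +ᶻ lookup (q x ⊖ q y) l   ≡⟨ cong (lookup w l +ᶻ_) (q-⊖-off l≢x l≢y) ⟩
    lookup w l +ᶻ 0ᶻ                     ≡⟨ identityʳ _ ⟩
    lookup w l                           ∎

  ⊖-q-⊖-agreeOff : ∀ x y w → AgreeOff x y w (w ⊖ (q x ⊖ q y))
  ⊖-q-⊖-agreeOff x y w l l≢x l≢y = begin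
    lookup (w ⊖ (q x ⊖ q y)) l              ≡⟨ lookup-zipWith (λ a b → a +ᶻ -ᶻ b) l w (q x ⊖ q y) ⟩
    lookup w l +ᶻ -ᶻ lookup (q x ⊖ q y) l   ≡⟨ cong (λ a → lookup w l +ᶻ -ᶻ a) (q-⊖-off l≢x l≢y) ⟩
    lookup w l +ᶻ -ᶻ 0ᶻ                     ≡⟨ cong (lookup w l +ᶻ_) ε⁻¹≈ε ⟩
    lookup w l +ᶻ 0ᶻ                        ≡⟨ identityʳ _ ⟩
    lookup w l                              ∎

  init-Σᶻ-injective : ∀ {n} (u v : Vec (Fin m) (suc n)) → init u ≡ init v → Σᶻ u ≡ Σᶻ v → u ≡ v
  init-Σᶻ-injective {zero}  (x ∷ []) (y ∷ []) _ Σ≡ = cong (_∷ []) (∙-cancelʳ 0ᶻ x y Σ≡)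
  init-Σᶻ-injective {suc n} (x ∷ u) (y ∷ v) init≡ Σ≡ with refl , init≡′ ← ∷-injective init≡ =
    cong (x ∷_) (init-Σᶻ-injective u v init≡′ (∙-cancelˡ x (Σᶻ u) (Σᶻ v) Σ≡))

  encode : A → Fin (m ^ 6)
  encode (w , _) = funToFin (lookup (init w))

  encode-injective : Injective _≡_ _≡_ encode
  encode-injective {w , w∈A} {w′ , w′∈A} eq = A-≡ (init-Σᶻ-injective w w′ init≡ (trans w∈A (sym w′∈A)))
    where
      lookup≗ : lookup (init w) ≗ lookup (init w′)
      lookup≗ i = begin
        lookup (init w) i                          ≡⟨ finToFun-funToFin (lookup (init w)) i ⟨
        finToFun (funToFin (lookup (init w))) i    ≡⟨ cong (λ k → finToFun k i) eq ⟩
        finToFun (funToFin (lookup (init w′))) i   ≡⟨ finToFun-funToFin (lookup (init w′)) i ⟩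
        lookup (init w′) i                         ∎

      init≡ : init w ≡ init w′
      init≡ = trans (sym (tabulate∘lookup (init w))) (trans (tabulate-cong lookup≗) (tabulate∘lookup (init w′)))

  inc dec : Fin m → Fin m
  inc x = x +ᶻ 1ᶻ
  dec x = x +ᶻ -ᶻ 1ᶻ

  -- w ⊕ q i computed coordinatewise: it normalises far faster than w ⊕ q i, which the orbit computations need.
  addQ : Fin 7 → V → V
  addQ 0F (x₀ ∷ x₁ ∷ x₂ ∷ x₃ ∷ x₄ ∷ x₅ ∷ x₆ ∷ []) = inc x₀ ∷ x₁ ∷ x₂ ∷ x₃ ∷ x₄ ∷ x₅ ∷ dec x₆ ∷ []
  addQ 1F (x₀ ∷ x₁ ∷ x₂ ∷ x₃ ∷ x₄ ∷ x₅ ∷ x₆ ∷ []) = x₀ ∷ inc x₁ ∷ x₂ ∷ x₃ ∷ x₄ ∷ x₅ ∷ dec x₆ ∷ []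
  addQ 2F (x₀ ∷ x₁ ∷ x₂ ∷ x₃ ∷ x₄ ∷ x₅ ∷ x₆ ∷ []) = x₀ ∷ x₁ ∷ inc x₂ ∷ x₃ ∷ x₄ ∷ x₅ ∷ dec x₆ ∷ []
  addQ 3F (x₀ ∷ x₁ ∷ x₂ ∷ x₃ ∷ x₄ ∷ x₅ ∷ x₆ ∷ []) = x₀ ∷ x₁ ∷ x₂ ∷ inc x₃ ∷ x₄ ∷ x₅ ∷ dec x₆ ∷ []
  addQ 4F (x₀ ∷ x₁ ∷ x₂ ∷ x₃ ∷ x₄ ∷ x₅ ∷ x₆ ∷ []) = x₀ ∷ x₁ ∷ x₂ ∷ x₃ ∷ inc x₄ ∷ x₅ ∷ dec x₆ ∷ []
  addQ 5F (x₀ ∷ x₁ ∷ x₂ ∷ x₃ ∷ x₄ ∷ x₅ ∷ x₆ ∷ []) = x₀ ∷ x₁ ∷ x₂ ∷ x₃ ∷ x₄ ∷ inc x₅ ∷ dec x₆ ∷ []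
  addQ 6F w = w

  private
    inc-correct : ∀ x → inc x ≡ x +ᶻ (1ᶻ +ᶻ -ᶻ 0ᶻ)
    inc-correct x = cong (x +ᶻ_) (sym (trans (cong (1ᶻ +ᶻ_) ε⁻¹≈ε) (identityʳ 1ᶻ)))

    dec-correct : ∀ x → dec x ≡ x +ᶻ (0ᶻ +ᶻ -ᶻ 1ᶻ)
    dec-correct x = cong (x +ᶻ_) (sym (identityˡ (-ᶻ 1ᶻ)))

    keep : ∀ x → x ≡ x +ᶻ (0ᶻ +ᶻ -ᶻ 0ᶻ)
    keep x = sym (trans (cong (x +ᶻ_) (inverseʳ 0ᶻ)) (identityʳ x))

    ∷₇ : ∀ {x₀ x₁ x₂ x₃ x₄ x₅ x₆ y₀ y₁ y₂ y₃ y₄ y₅ y₆ : Fin m} →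
         x₀ ≡ y₀ → x₁ ≡ y₁ → x₂ ≡ y₂ → x₃ ≡ y₃ → x₄ ≡ y₄ → x₅ ≡ y₅ → x₆ ≡ y₆ →
         x₀ ∷ x₁ ∷ x₂ ∷ x₃ ∷ x₄ ∷ x₅ ∷ x₆ ∷ [] ≡ y₀ ∷ y₁ ∷ y₂ ∷ y₃ ∷ y₄ ∷ y₅ ∷ y₆ ∷ []
    ∷₇ refl refl refl refl refl refl refl = refl

  addQ-correct : ∀ i w → addQ i w ≡ w ⊕ q i
  addQ-correct 0F (x₀ ∷ x₁ ∷ x₂ ∷ x₃ ∷ x₄ ∷ x₅ ∷ x₆ ∷ []) =
    ∷₇ (inc-correct x₀) (keep x₁) (keep x₂) (keep x₃) (keep x₄) (keep x₅) (dec-correct x₆)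
  addQ-correct 1F (x₀ ∷ x₁ ∷ x₂ ∷ x₃ ∷ x₄ ∷ x₅ ∷ x₆ ∷ []) =
    ∷₇ (keep x₀) (inc-correct x₁) (keep x₂) (keep x₃) (keep x₄) (keep x₅) (dec-correct x₆)
  addQ-correct 2F (x₀ ∷ x₁ ∷ x₂ ∷ x₃ ∷ x₄ ∷ x₅ ∷ x₆ ∷ []) =
    ∷₇ (keep x₀) (keep x₁) (inc-correct x₂) (keep x₃) (keep x₄) (keep x₅) (dec-correct x₆)
  addQ-correct 3F (x₀ ∷ x₁ ∷ x₂ ∷ x₃ ∷ x₄ ∷ x₅ ∷ x₆ ∷ []) =
    ∷₇ (keep x₀) (keep x₁) (keep x₂) (inc-correct x₃) (keep x₄) (keep x₅) (dec-correct x₆)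
  addQ-correct 4F (x₀ ∷ x₁ ∷ x₂ ∷ x₃ ∷ x₄ ∷ x₅ ∷ x₆ ∷ []) =
    ∷₇ (keep x₀) (keep x₁) (keep x₂) (keep x₃) (inc-correct x₄) (keep x₅) (dec-correct x₆)
  addQ-correct 5F (x₀ ∷ x₁ ∷ x₂ ∷ x₃ ∷ x₄ ∷ x₅ ∷ x₆ ∷ []) =
    ∷₇ (keep x₀) (keep x₁) (keep x₂) (keep x₃) (keep x₄) (inc-correct x₅) (dec-correct x₆)
  addQ-correct 6F w = sym (begin
    zipWith _+ᶻ_ w (replicate 7 0ᶻ)   ≡⟨ zipWith-replicate₂ _+ᶻ_ w 0ᶻ ⟩
    map (_+ᶻ 0ᶻ) w                    ≡⟨ map-cong identityʳ w ⟩
    map id w                          ≡⟨ map-id w ⟩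
    w                                 ∎)

-- The certificates

open Z 7 using () renaming (_+ᶻ_ to _+₇_; -ᶻ_ to -₇_)
module ℤ₇ = ZProperties 7

record Parameters (m : ℕ) : Set where
  field
    c j a  : Fin 7
    target : Vec (Fin m) 7

Admissible : ∀ {m} → Parameters m → Set
Admissible p = a ≢ c × a ≢ j +₇ c × j +₇ a ≢ c
  where open Parameters p

module _ {m : ℕ} .{{_ : NonZero m}} (p : Parameters m) where
  open Z m
  open Parameters p

  matches : V → Fin 7 → Bool
  matches w k = does (lookup w (k +₇ a) ≟ lookup target (k +₇ a))

  edge : V → Fin 7 → Bool
  edge w = ℤ₇.edges j (matches w)

  dir : V → Fin 7 → Fin 7
  dir w κ = ℤ₇.swapPairs j (edge w) κ +₇ c

  edge-cong : ∀ k {w w′} → lookup w′ (k +₇ a) ≡ lookup w (k +₇ a) →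
              lookup w′ ((k +₇ j) +₇ a) ≡ lookup w ((k +₇ j) +₇ a) → edge w′ k ≡ edge w k
  edge-cong k = cong₂ (λ x y → does (x ≟ lookup target (k +₇ a)) ∧ not (does (y ≟ lookup target ((k +₇ j) +₇ a))))

  module _ (admissible : Admissible p) where
    open VectorProperties m

    private
      reads-avoid-same : ∀ k → k +₇ a ≢ k +₇ c
      reads-avoid-same k eq = proj₁ admissible (ℤ₇.∙-cancelˡ k a c eq)

      reads-avoid-next : ∀ k → k +₇ a ≢ (k +₇ j) +₇ c
      reads-avoid-next k eq = proj₁ (proj₂ admissible) (ℤ₇.∙-cancelˡ k a (j +₇ c) (trans eq (ℤ₇.+ᶻ-assoc k j c)))

      reads-avoid-previous : ∀ k → (k +₇ j) +₇ a ≢ k +₇ c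
      reads-avoid-previous k eq = proj₂ (proj₂ admissible) (ℤ₇.∙-cancelˡ k (j +₇ a) c (trans (sym (ℤ₇.+ᶻ-assoc k j a)) eq))

    edge-stable : ∀ k {w w′} → AgreeOff (k +₇ c) ((k +₇ j) +₇ c) w w′ → edge w′ k ≡ edge w k
    edge-stable k {w} {w′} agree = edge-cong k {w} {w′}
      (agree _ (reads-avoid-same k) (reads-avoid-next k))
      (agree _ (reads-avoid-previous k) (reads-avoid-same (k +₇ j)))

    dir-stable : ∀ κ w w′ → AgreeOff (dir w κ) (κ +₇ c) w w′ → dir w′ κ ≡ dir w κ
    dir-stable κ w w′ agree = by-cases (edge w κ) refl (edge w k) refl
      where
        k : Fin 7
        k = κ +₇ -₇ j

        κ≡k+j : κ ≡ k +₇ j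
        κ≡k+j = sym (ℤ₇.//-rightDividesˡ j κ)

        κ+c≡k+j+c : κ +₇ c ≡ (k +₇ j) +₇ c
        κ+c≡k+j+c = cong (_+₇ c) κ≡k+j

        by-cases : ∀ b → edge w κ ≡ b → ∀ b′ → edge w k ≡ b′ → dir w′ κ ≡ dir w κ
        by-cases true up _ _ = begin
          dir w′ κ        ≡⟨ cong (_+₇ c) (ℤ₇.swapPairs-forward (edge w′) up′) ⟩
          (κ +₇ j) +₇ c   ≡⟨ dw ⟨
          dir w κ         ∎
          where
            dw : dir w κ ≡ (κ +₇ j) +₇ c
            dw = cong (_+₇ c) (ℤ₇.swapPairs-forward (edge w) up)
            up′ : edge w′ κ ≡ true
            up′ = trans (edge-stable κ {w} {w′} (λ l l≢κ+c l≢κ+j+c → agree l (l≢κ+j+c ∘ flip trans dw) l≢κ+c)) up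
        by-cases false up true down = begin
          dir w′ κ        ≡⟨ cong (_+₇ c) (ℤ₇.swapPairs-backward (edge w′) up′ down′) ⟩
          k +₇ c          ≡⟨ dw ⟨
          dir w κ         ∎
          where
            dw : dir w κ ≡ k +₇ c
            dw = cong (_+₇ c) (ℤ₇.swapPairs-backward (edge w) up down)
            down′ : edge w′ k ≡ true
            down′ = trans (edge-stable k {w} {w′} (λ l l≢k+c l≢k+j+c →
                      agree l (l≢k+c ∘ flip trans dw) (l≢k+j+c ∘ flip trans κ+c≡k+j+c))) down
            up′ : edge w′ κ ≡ false
            up′ = begin
              edge w′ κ                      ≡⟨ cong (edge w′) κ≡k+j ⟩
              edge w′ (k +₇ j)               ≡⟨ cong (_∧ edge w′ (k +₇ j)) down′ ⟨
              edge w′ k ∧ edge w′ (k +₇ j)   ≡⟨ ℤ₇.edges-disjoint j (matches w′) k ⟩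
              false                          ∎
        by-cases false up false down = begin
          dir w′ κ        ≡⟨ cong (_+₇ c) (ℤ₇.swapPairs-fixed (edge w′) up′ down′) ⟩
          κ +₇ c          ≡⟨ dw ⟨
          dir w κ         ∎
          where
            dw : dir w κ ≡ κ +₇ c
            dw = cong (_+₇ c) (ℤ₇.swapPairs-fixed (edge w) up down)
            up′ : edge w′ κ ≡ false
            up′ = trans (edge-stable κ {w} {w′} (λ l l≢κ+c _ → agree l (l≢κ+c ∘ flip trans dw) l≢κ+c)) up
            down′ : edge w′ k ≡ false
            down′ = trans (edge-stable k {w} {w′} (λ l _ l≢k+j+c →
                      agree l (l≢k+j+c ∘ flip trans (trans dw κ+c≡k+j+c)) (l≢k+j+c ∘ flip trans κ+c≡k+j+c))) down

module Construction (m : ℕ) .{{_ : NonZero m}} (q∈A : ∀ i → Z.InA m (Z.q m i))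
                    (par : Fin m → Parameters m) (admissible : ∀ t → Admissible (par t)) where
  open Z m
  open VectorProperties m
  open Cert q∈A

  d : Fin m → A → Fin 7 → Fin 7
  d t x κ = dir (par t) (proj₁ x) κ

  d-bijective : ∀ t w → Bijective _≡_ _≡_ (λ κ → d t w κ)
  d-bijective t w =
    ℤ₇.swapPairs-translate-bijective j c (edge (par t) (proj₁ w)) (ℤ₇.edges-disjoint j (matches (par t) (proj₁ w)))
    where open Parameters (par t)

  P-bijective : ∀ t κ → Bijective _≡_ _≡_ (P d t κ)
  P-bijective t κ = restrict-bijective (λ _ → refl) shift-unshift unshift-shift unshift-closed
    where
      open Parameters (par t)

      δ : V → Fin 7
      δ w = dir (par t) w κ

      o : V
      o = q (κ +₇ c)

      open Shear _⊕_ _⊖_ ⊕-⊖-cancel ⊖-⊕-cancel ⊕-⊖-assoc (q ∘ δ) o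
        (λ w → cong q (dir-stable (par t) (admissible t) κ w (w ⊕ (q (δ w) ⊖ o)) (⊕-q-⊖-agreeOff (δ w) (κ +₇ c) w)))
        (λ w → cong q (dir-stable (par t) (admissible t) κ w (w ⊖ (q (δ w) ⊖ o)) (⊖-q-⊖-agreeOff (δ w) (κ +₇ c) w)))

      unshift-closed : ∀ y → InA y → InA (unshift y)
      unshift-closed y y∈A = InA-⊖ {y ⊖ o} {q (δ (y ⊖ o)) ⊖ o}
        (InA-⊖ {y} {o} y∈A (q∈A (κ +₇ c)))
        (InA-⊖ {q (δ (y ⊖ o))} {o} (q∈A (δ (y ⊖ o))) (q∈A (κ +₇ c)))

  stepᵥ : Fin 7 → V → Fin m → V
  stepᵥ κ w t = addQ (dir (par t) w κ) w

  sweepᵥ : Fin 7 → V → V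
  sweepᵥ κ w = foldl (stepᵥ κ) w (allFin m)

  proj₁-sweep : ∀ κ x → proj₁ (sweep d κ x) ≡ sweepᵥ κ (proj₁ x)
  proj₁-sweep κ x = foldl-fusion proj₁ {λ y t → P d t κ y} {stepᵥ κ}
    (λ y t → sym (addQ-correct (dir (par t) (proj₁ y) κ) (proj₁ y))) x (allFin m)

  sweep-injective : ∀ κ → Injective _≡_ _≡_ (sweep d κ)
  sweep-injective κ = foldl-injective (λ t → proj₁ (P-bijective t κ)) (allFin m)

  sweep-isSingleCycle : ∀ κ → ExactPeriod (sweepᵥ κ) (m ^ 6) 0⃗ → IsSingleCycle (sweep d κ) (m ^ 6)
  sweep-isSingleCycle κ period = exactPeriod⇒isSingleCycle (sweep d κ) (sweep-injective κ) encode encode-injective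
    (exactPeriod-reflect {f = sweep d κ} {g = sweepᵥ κ} {π = proj₁} A-≡ (proj₁-sweep κ) {x = 0⃗ , 0⃗∈A} period)

  _≟ᵥ_ : DecidableEquality V
  _≟ᵥ_ = ≡-dec _≟_

  certificate : ∀ n → m ^ 6 ≡ suc n →
                (∀ κ → firstHitAt _≟ᵥ_ (sweepᵥ κ) 0⃗ n (sweepᵥ κ 0⃗) ≡ true) → IsCertificate d
  certificate n N≡1+n hits = d-bijective , P-bijective , λ κ →
    sweep-isSingleCycle κ (firstHitAt⇒exactPeriod _≟ᵥ_ (sweepᵥ κ) 0⃗ n N≡1+n (hits κ))

parameters₃ : Fin 3 → Parameters 3
parameters₃ 0F = record { c = # 0 ; j = # 6 ; a = # 5 ; target = replicate 6 (# 0) ∷ʳ # 0 }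
parameters₃ 1F = record { c = # 5 ; j = # 1 ; a = # 2 ; target = replicate 6 (# 0) ∷ʳ # 2 }
parameters₃ 2F = record { c = # 2 ; j = # 6 ; a = # 6 ; target = replicate 6 (# 1) ∷ʳ # 2 }

parameters₅ : Fin 5 → Parameters 5
parameters₅ 0F = record { c = # 6 ; j = # 4 ; a = # 1 ; target = replicate 6 (# 4) ∷ʳ # 4 }
parameters₅ 1F = record { c = # 4 ; j = # 6 ; a = # 0 ; target = replicate 6 (# 2) ∷ʳ # 1 }
parameters₅ 2F = record { c = # 1 ; j = # 1 ; a = # 3 ; target = replicate 6 (# 0) ∷ʳ # 3 }
parameters₅ 3F = record { c = # 6 ; j = # 5 ; a = # 2 ; target = replicate 6 (# 2) ∷ʳ # 4 }
parameters₅ 4F = record { c = # 6 ; j = # 6 ; a = # 1 ; target = replicate 6 (# 2) ∷ʳ # 3 }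

admissible₃ : ∀ t → Admissible (parameters₃ t)
admissible₃ 0F = (λ ()) , (λ ()) , (λ ())
admissible₃ 1F = (λ ()) , (λ ()) , (λ ())
admissible₃ 2F = (λ ()) , (λ ()) , (λ ())

admissible₅ : ∀ t → Admissible (parameters₅ t)
admissible₅ 0F = (λ ()) , (λ ()) , (λ ())
admissible₅ 1F = (λ ()) , (λ ()) , (λ ())
admissible₅ 2F = (λ ()) , (λ ()) , (λ ())
admissible₅ 3F = (λ ()) , (λ ()) , (λ ())
admissible₅ 4F = (λ ()) , (λ ()) , (λ ())

module C₃ = Construction 3 q∈A-3 parameters₃ admissible₃
module C₅ = Construction 5 q∈A-5 parameters₅ admissible₅

-- Each refl below makes the type checker run an orbit of length m ^ 6.
theorem4p2 : HasCertificate3 × HasCertificate5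
theorem4p2 =
  (C₃.d , C₃.certificate 728 refl
    λ { 0F → refl ; 1F → refl ; 2F → refl ; 3F → refl ; 4F → refl ; 5F → refl ; 6F → refl }) ,
  (C₅.d , C₅.certificate 15624 refl
    λ { 0F → refl ; 1F → refl ; 2F → refl ; 3F → refl ; 4F → refl ; 5F → refl ; 6F → refl })
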